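{- Let $k\ge 2$ be an integer and let $T$ be a $k$-leaf root of a connected graph $G$. Then $d_{\min}(T)\le k/2$.
   Context: For an integer $k\ge 2$, a $k$-leaf root of a graph $G$ is a tree $T$ whose leaf set is exactly $V(G)$ such that for all distinct $x,y\in V(G)$, $xy\in E(G)$ iff $\mathrm{dist}_T(x,y)\le k$. A center vertex of a tree $T$ is a vertex $z$ minimizing $\max_{x\in V(T)}\mathrm{dist}_T(x,z)$. A min-max center of $T$ is a center vertex $z$ maximizing $\min\{\mathrm{dist}_T(z,v): v \text{ a leaf of } T\}$ among all center vertices; the leaf distance $d_{\min}(T)$ is $\min\{\mathrm{dist}_T(z,v): v\text{ a leaf of }T\}$ for a min-max center $z$. -}

module Defs where

open import Data.Nat using (ℕ; zero; suc; _+_; _*_; _≤_)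
open import Data.Fin using (Fin; zero; suc; inject₁; fromℕ)
open import Data.Product using (Σ; ∃; _×_; _,_)
open import Relation.Binary.PropositionalEquality using (_≡_; _≢_)
open import Relation.Nullary using (¬_)
open import Function.Definitions using (Injective)
open import Function.Bundles using (_⇔_)

record Graph (n : ℕ) : Set₁ where
  field
    Adj     : Fin n → Fin n → Set
    symm    : ∀ {x y} → Adj x y → Adj y x
    irrefl  : ∀ {x} → ¬ Adj x x
open Graph public

data Walk {n : ℕ} (G : Graph n) : Fin n → Fin n → ℕ → Set where
  here : ∀ {x} → Walk G x x 0
  step : ∀ {x y z l} → Adj G x y → Walk G y z l → Walk G x z (suc l)

DistLe : ∀ {n} → Graph n → Fin n → Fin n → ℕ → Set
DistLe G x y r = Σ ℕ λ l → Walk G x y l × l ≤ r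

Connected : ∀ {n} → Graph n → Set
Connected G = ∀ x y → Σ ℕ λ l → Walk G x y l

Cycle : ∀ {n} → Graph n → Set
Cycle {n} G = Σ ℕ λ l → Σ (Fin (3 + l) → Fin n) λ c →
  Injective _≡_ _≡_ c
  × (∀ (i : Fin (2 + l)) → Adj G (c (inject₁ i)) (c (suc i)))
  × Adj G (c (fromℕ (2 + l))) (c zero)

Acyclic : ∀ {n} → Graph n → Set
Acyclic G = ¬ Cycle G

IsTree : ∀ {n} → Graph n → Set
IsTree G = Connected G × Acyclic G

Leaf : ∀ {n} → Graph n → Fin n → Set
Leaf G v = Σ _ λ u → Adj G v u × (∀ w → Adj G v w → w ≡ u)

-- T (on Fin n) is a k-leaf root of G (on Fin m), the leaf set of T being identified
-- with V(G) through the injection ι whose image is exactly the leaves of T.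
IsKLeafRoot : ∀ {m n} → ℕ → Graph n → Graph m → (Fin m → Fin n) → Set
IsKLeafRoot k T G ι =
  IsTree T
  × Injective _≡_ _≡_ ι
  × (∀ v → Leaf T v ⇔ (Σ _ λ i → ι i ≡ v))
  × (∀ i j → i ≢ j → Adj G i j ⇔ DistLe T (ι i) (ι j) k)

EccLe : ∀ {n} → Graph n → Fin n → ℕ → Set
EccLe T z r = ∀ x → DistLe T z x r

IsCenter : ∀ {n} → Graph n → Fin n → Set
IsCenter T z = ∀ w r → EccLe T w r → EccLe T z r

LeafDistGe : ∀ {n} → Graph n → Fin n → ℕ → Set
LeafDistGe T z r = ∀ v → Leaf T v → ∀ d → DistLe T z v d → r ≤ d

IsMinMaxCenter : ∀ {n} → Graph n → Fin n → Set
IsMinMaxCenter T z =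
  IsCenter T z × (∀ w → IsCenter T w → ∀ r → LeafDistGe T w r → LeafDistGe T z r)

-- d_min(T) ≤ r, computed at a (given) min-max center z:
-- some leaf v has dist(z,v) ≤ r. Here we state 2·d_min ≤ k.

{-# OPTIONS --safe #-}
module Submission where

-- Let z be any vertex of T and suppose every leaf is farther than k/2 from z. Two leaves
-- adjacent in G are within distance k in T, so their geodesics to z cannot enter z through
-- different neighbours of z; as G is connected, all leaves lie behind a single neighbour s.
-- A non-backtracking walk into z can be prolonged backwards until it starts at a leaf, so z
-- has no neighbour other than s: z is itself a leaf, at distance 0 from itself.

open import Defs
open import Data.Nat using (ℕ; zero; suc; pred; _+_; _*_; _≤_; _<_; z≤n; s≤s; _≤?_)
open import Data.Nat.Properties
open import Data.Fin using (Fin; toℕ; inject₁; fromℕ) renaming (zero to fzero; suc to fsuc)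
open import Data.Fin.Properties using (toℕ-injective; toℕ-inject₁; toℕ-fromℕ; toℕ<n; injective⇒≤; any?)
  renaming (_≟_ to _≟ᶠ_)
open import Data.Product using (Σ; _×_; _,_; proj₁; proj₂)
open import Data.Sum using (inj₁; inj₂)
open import Data.Unit using (⊤; tt)
open import Data.Empty using (⊥; ⊥-elim)
open import Relation.Nullary using (yes; no)
open import Relation.Binary.PropositionalEquality
open import Function.Definitions using (Injective)
open import Function.Bundles using (Equivalence; _⇔_)

module Walks {n : ℕ} (T : Graph n) where

  adjacent⇒≢ : ∀ {x y} → Adj T x y → x ≢ y
  adjacent⇒≢ a refl = irrefl T a

  -- Positions past the end of a walk give its endpoint.
  vertexAt : ∀ {x y l} → Walk T x y l → ℕ → Fin n
  vertexAt {x} _ zero = x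
  vertexAt {x} here (suc _) = x
  vertexAt (step _ p) (suc i) = vertexAt p i

  second : ∀ {x y l} → Walk T x y l → Fin n
  second p = vertexAt p 1

  penultimate : ∀ {x y l} → Walk T x y l → Fin n
  penultimate {l = l} p = vertexAt p (pred l)

  vertexAt-end : ∀ {x y l} (p : Walk T x y l) → vertexAt p l ≡ y
  vertexAt-end here = refl
  vertexAt-end (step _ p) = vertexAt-end p

  vertexAt-adjacent : ∀ {x y l i} (p : Walk T x y l) → i < l → Adj T (vertexAt p i) (vertexAt p (suc i))
  vertexAt-adjacent {i = zero} (step a _) _ = a
  vertexAt-adjacent {i = suc i} (step _ p) (s≤s i<l) = vertexAt-adjacent p i<l

  penultimate-adjacent : ∀ {x y l} (p : Walk T x y l) → 1 ≤ l → Adj T (penultimate p) y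
  penultimate-adjacent {l = suc l} p _ =
    subst (Adj T (vertexAt p l)) (vertexAt-end p) (vertexAt-adjacent p ≤-refl)

  _++_ : ∀ {x y w l₁ l₂} → Walk T x y l₁ → Walk T y w l₂ → Walk T x w (l₁ + l₂)
  here ++ q = q
  step a p ++ q = step a (p ++ q)

  snoc : ∀ {x y w l} → Walk T x y l → Adj T y w → Walk T x w (suc l)
  snoc here a = step a here
  snoc (step b p) a = step b (snoc p a)

  rev : ∀ {x y l} → Walk T x y l → Walk T y x l
  rev here = here
  rev (step a p) = snoc (rev p) (symm T a)

  penultimate-snoc : ∀ {x y w l} (p : Walk T x y l) (a : Adj T y w) → penultimate (snoc p a) ≡ y
  penultimate-snoc here _ = refl
  penultimate-snoc (step _ here) _ = refl
  penultimate-snoc (step _ (step b p)) a = penultimate-snoc (step b p) a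

  second-snoc : ∀ {x y w l} (p : Walk T x y l) (a : Adj T y w) → 1 ≤ l → second (snoc p a) ≡ second p
  second-snoc (step _ _) _ _ = refl

  second-rev : ∀ {x y l} (p : Walk T x y l) → second (rev p) ≡ penultimate p
  second-rev here = refl
  second-rev (step _ here) = refl
  second-rev (step a (step b p)) =
    trans (second-snoc (rev (step b p)) (symm T a) (s≤s z≤n)) (second-rev (step b p))

  penultimate-rev : ∀ {x y l} (p : Walk T x y l) → penultimate (rev p) ≡ second p
  penultimate-rev here = refl
  penultimate-rev (step a p) = penultimate-snoc (rev p) (symm T a)

  NonBacktracking : ∀ {x y l} → Walk T x y l → Set
  NonBacktracking here = ⊤
  NonBacktracking (step {x} _ p) = x ≢ second p × NonBacktracking p

  snoc-nonBacktracking : ∀ {x y w l} (p : Walk T x y l) (a : Adj T y w) →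
    NonBacktracking p → penultimate p ≢ w → NonBacktracking (snoc p a)
  snoc-nonBacktracking here _ _ p≢w = p≢w , tt
  snoc-nonBacktracking (step _ here) a _ p≢w = p≢w , adjacent⇒≢ a , tt
  snoc-nonBacktracking (step _ (step b p)) a (x≢y , nb) p≢w =
    x≢y , snoc-nonBacktracking (step b p) a nb p≢w

  rev-nonBacktracking : ∀ {x y l} (p : Walk T x y l) → NonBacktracking p → NonBacktracking (rev p)
  rev-nonBacktracking here _ = tt
  rev-nonBacktracking (step a p) (x≢y , nb) =
    snoc-nonBacktracking (rev p) (symm T a) (rev-nonBacktracking p nb)
      (λ e → x≢y (sym (trans (sym (penultimate-rev p)) e)))

  ++-nonBacktracking : ∀ {x y w l₁ l₂} (p : Walk T x y l₁) (q : Walk T y w l₂) →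
    NonBacktracking p → NonBacktracking q → penultimate p ≢ second q → NonBacktracking (p ++ q)
  ++-nonBacktracking here _ _ nq _ = nq
  ++-nonBacktracking (step _ here) _ _ nq p≢q = p≢q , nq
  ++-nonBacktracking (step _ (step b p)) q (x≢y , np) nq p≢q =
    x≢y , ++-nonBacktracking (step b p) q np nq p≢q

  shortcut : ∀ {x y l} → Walk T x y l →
    Σ ℕ λ l′ → Σ (Walk T x y l′) λ p → NonBacktracking p × l′ ≤ l
  shortcut here = 0 , here , tt , z≤n
  shortcut (step {x} a p) with shortcut p
  ... | _ , here , _ , _ = 1 , step a here , (adjacent⇒≢ a , tt) , s≤s z≤n
  ... | suc l′ , step {y = w} b q , nb@(_ , nq) , l′<l with x ≟ᶠ w
  ...   | yes refl = l′ , q , nq , ≤-trans (n≤1+n l′) (m≤n⇒m≤1+n l′<l)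
  ...   | no x≢w = suc (suc l′) , step a (step b q) , (x≢w , nb) , s≤s l′<l

  VertexInjective : ∀ {x y l} → Walk T x y l → Set
  VertexInjective {l = l} p = ∀ {i j} → i ≤ l → j ≤ l → vertexAt p i ≡ vertexAt p j → i ≡ j

  vertices : ∀ {x y l} → Walk T x y l → Fin (suc l) → Fin n
  vertices p i = vertexAt p (toℕ i)

  vertices-injective : ∀ {x y l} (p : Walk T x y l) → VertexInjective p → Injective _≡_ _≡_ (vertices p)
  vertices-injective p inj {i} {j} e =
    toℕ-injective (inj (≤-pred (toℕ<n i)) (≤-pred (toℕ<n j)) e)

  take : ∀ {x y l} (p : Walk T x y l) (j : ℕ) → j ≤ l → Walk T x (vertexAt p j) j
  take _ zero _ = here
  take (step a p) (suc j) (s≤s j≤l) = step a (take p j j≤l)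

  vertexAt-take : ∀ {x y l i j} (p : Walk T x y l) (j≤l : j ≤ l) → i ≤ j →
    vertexAt (take p j j≤l) i ≡ vertexAt p i
  vertexAt-take {i = zero} _ _ _ = refl
  vertexAt-take {i = suc _} (step _ p) (s≤s j≤l) (s≤s i≤j) = vertexAt-take p j≤l i≤j

  take-vertexInjective : ∀ {x y l j} (p : Walk T x y l) (j≤l : j ≤ l) →
    VertexInjective p → VertexInjective (take p j j≤l)
  take-vertexInjective p j≤l inj i≤j i′≤j e =
    inj (≤-trans i≤j j≤l) (≤-trans i′≤j j≤l)
      (trans (sym (vertexAt-take p j≤l i≤j)) (trans e (vertexAt-take p j≤l i′≤j)))

  closingEdge⇒cycle : ∀ {x y l} (p : Walk T y x (2 + l)) → VertexInjective p → Adj T x y → Cycle T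
  closingEdge⇒cycle {l = l} p inj x~y =
    l , vertices p , vertices-injective p inj , edges , closing
    where
    edges : ∀ (i : Fin (2 + l)) → Adj T (vertices p (inject₁ i)) (vertices p (fsuc i))
    edges i rewrite toℕ-inject₁ i = vertexAt-adjacent p (toℕ<n i)
    closing : Adj T (vertices p (fromℕ (2 + l))) (vertices p fzero)
    closing rewrite toℕ-fromℕ (2 + l) | vertexAt-end p = x~y

  module InAcyclic (acyclic : Acyclic T) where

    -- Revisiting x after two or more steps would close a cycle through the edge x ~ y.
    start-not-revisited : ∀ {x y w l j} (x~y : Adj T x y) (q : Walk T y w l) →
      VertexInjective q → x ≢ second q → j ≤ l → x ≢ vertexAt q j
    start-not-revisited {j = zero} x~y _ _ _ _ = adjacent⇒≢ x~y
    start-not-revisited {j = suc zero} _ _ _ x≢q _ = x≢q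
    start-not-revisited {y = y} {j = suc (suc j)} x~y q inj _ j≤l e =
      acyclic (closingEdge⇒cycle (take q (2 + j) j≤l) (take-vertexInjective q j≤l inj)
                 (subst (λ t → Adj T t y) e x~y))

    nonBacktracking⇒vertexInjective : ∀ {x y l} (p : Walk T x y l) →
      NonBacktracking p → VertexInjective p
    nonBacktracking⇒vertexInjective here _ z≤n z≤n _ = refl
    nonBacktracking⇒vertexInjective (step x~y q) (x≢q , nq) = inj
      where
      injq : VertexInjective q
      injq = nonBacktracking⇒vertexInjective q nq
      inj : VertexInjective (step x~y q)
      inj {zero} {zero} _ _ _ = refl
      inj {zero} {suc j} _ (s≤s j≤l) e = ⊥-elim (start-not-revisited x~y q injq x≢q j≤l e)
      inj {suc i} {zero} (s≤s i≤l) _ e = ⊥-elim (start-not-revisited x~y q injq x≢q i≤l (sym e))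
      inj {suc i} {suc j} (s≤s i≤l) (s≤s j≤l) e = cong suc (injq i≤l j≤l e)

    closed-nonBacktracking : ∀ {x y l} (p : Walk T x y l) → NonBacktracking p → x ≡ y → l ≡ 0
    closed-nonBacktracking p nb x≡y =
      sym (nonBacktracking⇒vertexInjective p nb z≤n ≤-refl (trans x≡y (sym (vertexAt-end p))))

    nonBacktracking-length< : ∀ {x y l} (p : Walk T x y l) → NonBacktracking p → l < n
    nonBacktracking-length< p nb =
      injective⇒≤ (vertices-injective p (nonBacktracking⇒vertexInjective p nb))

    second-unique : ∀ {x y l₁ l₂} (p : Walk T x y l₁) (q : Walk T x y l₂) →
      NonBacktracking p → NonBacktracking q → 1 ≤ l₁ → second p ≡ second q
    second-unique {l₁ = suc l₁} p q np nq _ with second p ≟ᶠ second q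
    ... | yes e = e
    ... | no p≢q with closed-nonBacktracking (rev p ++ q)
                        (++-nonBacktracking (rev p) q (rev-nonBacktracking p np) nq
                           (λ e → p≢q (trans (sym (penultimate-rev p)) e)))
                        refl
    ... | ()

    nonBacktracking-length-unique : ∀ {x y l₁ l₂} (p : Walk T x y l₁) (q : Walk T x y l₂) →
      NonBacktracking p → NonBacktracking q → l₁ ≡ l₂
    nonBacktracking-length-unique here q _ nq = sym (closed-nonBacktracking q nq refl)
    nonBacktracking-length-unique p here np _ = closed-nonBacktracking p np refl
    nonBacktracking-length-unique (step a p) (step b q) np@(_ , np′) nq@(_ , nq′)
      with second-unique (step a p) (step b q) np nq (s≤s z≤n)
    ... | refl = cong suc (nonBacktracking-length-unique p q np′ nq′)

    penultimate-unique : ∀ {x y l₁ l₂} (p : Walk T x y l₁) (q : Walk T x y l₂) →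
      NonBacktracking p → NonBacktracking q → 1 ≤ l₁ → penultimate p ≡ penultimate q
    penultimate-unique p q np nq 1≤l₁ = begin
      penultimate p    ≡⟨ sym (second-rev p) ⟩
      second (rev p)   ≡⟨ second-unique (rev p) (rev q)
                            (rev-nonBacktracking p np) (rev-nonBacktracking q nq) 1≤l₁ ⟩
      second (rev q)   ≡⟨ second-rev q ⟩
      penultimate q    ∎
      where open ≡-Reasoning

    -- p ++ rev q is then non-backtracking, hence (by uniqueness of lengths) a shortest walk.
    distinctPenultimates⇒+≤length : ∀ {x y z l₁ l₂ l} (p : Walk T x z l₁) (q : Walk T y z l₂) →
      NonBacktracking p → NonBacktracking q → penultimate p ≢ penultimate q →
      Walk T x y l → l₁ + l₂ ≤ l
    distinctPenultimates⇒+≤length p q np nq p≢q w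
      with shortcut w
    ... | _ , w′ , nw′ , l′≤l =
      subst (_≤ _) (sym (nonBacktracking-length-unique (p ++ rev q) w′ npq nw′)) l′≤l
      where
      npq : NonBacktracking (p ++ rev q)
      npq = ++-nonBacktracking p (rev q) np (rev-nonBacktracking q nq)
              (λ e → p≢q (trans e (second-rev q)))

    EntersVia : (Fin n → Set) → Fin n → Fin n → Set
    EntersVia V z s = ∀ {x l} (p : Walk T x z l) → NonBacktracking p → 1 ≤ l → V x → penultimate p ≡ s

    -- A non-backtracking walk into z that cannot be prolonged backwards starts at a leaf,
    -- and such prolongations stop since walks have length < n.
    leavesEnterVia⇒allEnterVia : ∀ {z s} → EntersVia (Leaf T) z s → EntersVia (λ _ → ⊤) z s
    leavesEnterVia⇒allEnterVia {z} {s} viaLeaves {l = l} p np 1≤l _ = prolong n p np 1≤l (m≤m+n n l)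
      where
      prolong : ∀ fuel {x l} (p : Walk T x z l) → NonBacktracking p → 1 ≤ l → n ≤ fuel + l →
        penultimate p ≡ s
      prolong zero p np _ n≤l = ⊥-elim (<⇒≱ (nonBacktracking-length< p np) n≤l)
      prolong (suc fuel) {x} {suc l} p@(step {y = y} x~y _) np 1≤l n≤fuel+l with penultimate p ≟ᶠ s
      ... | yes e = e
      ... | no p≢s = ⊥-elim (p≢s (viaLeaves p np 1≤l (y , x~y , onlyNeighbour)))
        where
        onlyNeighbour : ∀ w → Adj T x w → w ≡ y
        onlyNeighbour w x~w with w ≟ᶠ y
        ... | yes e = e
        ... | no w≢y = ⊥-elim (p≢s (prolong fuel (step (symm T x~w) p) (w≢y , np) (s≤s z≤n)
                         (subst (n ≤_) (sym (+-suc fuel (suc l))) n≤fuel+l)))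

<-+-from-halves : ∀ {k a b} → k < 2 * a → k < 2 * b → k < a + b
<-+-from-halves {a = a} {b} k<2a k<2b with ≤-total a b
... | inj₁ a≤b = <-≤-trans k<2a (+-monoʳ-≤ a (subst (_≤ b) (sym (+-identityʳ a)) a≤b))
... | inj₂ b≤a = <-≤-trans k<2b (≤-trans (+-monoʳ-≤ b (subst (_≤ a) (sym (+-identityʳ b)) b≤a))
                                           (≤-reflexive (+-comm b a)))

module LeafRoot {m n k} {G : Graph m} {T : Graph n} {ι : Fin m → Fin n}
  (connectedG : Connected G) (connectedT : Connected T) (acyclic : Acyclic T)
  (leaves : ∀ v → Leaf T v ⇔ (Σ (Fin m) λ i → ι i ≡ v))
  (edges : ∀ i j → i ≢ j → Adj G i j ⇔ DistLe T (ι i) (ι j) k)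
  (z : Fin n) where

  open Walks T
  open InAcyclic acyclic

  geodesic : ∀ i → Σ ℕ λ l → Σ (Walk T (ι i) z l) λ p → NonBacktracking p × l ≤ proj₁ (connectedT (ι i) z)
  geodesic i = shortcut (proj₂ (connectedT (ι i) z))

  dist : Fin m → ℕ
  dist i = proj₁ (geodesic i)

  path : ∀ i → Walk T (ι i) z (dist i)
  path i = proj₁ (proj₂ (geodesic i))

  path-nonBacktracking : ∀ i → NonBacktracking (path i)
  path-nonBacktracking i = proj₁ (proj₂ (proj₂ (geodesic i)))

  branch : Fin m → Fin n
  branch i = penultimate (path i)

  module AllFar (far : ∀ i → k < 2 * dist i) where

    path-nonempty : ∀ i → 1 ≤ dist i
    path-nonempty i with dist i | far i
    ... | suc _ | _ = s≤s z≤n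

    branch-edge : ∀ {i j} → Adj G i j → branch i ≡ branch j
    branch-edge {i} {j} i~j with branch i ≟ᶠ branch j
    ... | yes e = e
    ... | no i≢j with Equivalence.to (edges i j (λ { refl → irrefl G i~j })) i~j
    ... | _ , w , l≤k = ⊥-elim (<⇒≱ (<-+-from-halves {a = dist i} (far i) (far j))
            (≤-trans (distinctPenultimates⇒+≤length (path i) (path j)
                        (path-nonBacktracking i) (path-nonBacktracking j) i≢j w) l≤k))

    branch-walk : ∀ {i j l} → Walk G i j l → branch i ≡ branch j
    branch-walk here = refl
    branch-walk (step i~j w) = trans (branch-edge i~j) (branch-walk w)

    leavesEnterVia-branch : ∀ i → EntersVia (Leaf T) z (branch i)
    leavesEnterVia-branch i {y} p np 1≤l leaf with Equivalence.to (leaves y) leaf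
    ... | j , refl =
      trans (penultimate-unique p (path j) np (path-nonBacktracking j) 1≤l)
            (branch-walk (proj₂ (connectedG j i)))

    z-leaf : Fin m → Leaf T z
    z-leaf i = branch i , symm T (penultimate-adjacent (path i) (path-nonempty i)) , onlyNeighbour
      where
      onlyNeighbour : ∀ w → Adj T z w → w ≡ branch i
      onlyNeighbour w z~w = leavesEnterVia⇒allEnterVia (leavesEnterVia-branch i)
        (step (symm T z~w) here) (adjacent⇒≢ (symm T z~w) , tt) (s≤s z≤n) tt

    impossible : Fin m → ⊥
    impossible i with Equivalence.to (leaves z) (z-leaf i)
    ... | j , ιj≡z = <⇒≢ (path-nonempty j)
                       (sym (closed-nonBacktracking (path j) (path-nonBacktracking j) ιj≡z))

  nearLeaf : Fin m → Σ (Fin n) λ v → Leaf T v × Σ ℕ λ d → DistLe T z v d × 2 * d ≤ k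
  nearLeaf i₀ with any? (λ i → 2 * dist i ≤? k)
  ... | yes (i , short) =
    ι i , Equivalence.from (leaves (ι i)) (i , refl) ,
    dist i , (dist i , rev (path i) , ≤-refl) , short
  ... | no none = ⊥-elim (AllFar.impossible (λ i → ≰⇒> (λ short → none (i , short))) i₀)

-- The bound holds at every vertex z.
lemma2 : ∀ {m n} (k : ℕ) → 2 ≤ k → 1 ≤ m
    → (G : Graph m) → Connected G
    → (T : Graph n) (ι : Fin m → Fin n) → IsKLeafRoot k T G ι
    → (z : Fin n) → IsMinMaxCenter T z
    → Σ (Fin n) λ v → Leaf T v × Σ ℕ λ d → DistLe T z v d × 2 * d ≤ k
lemma2 {suc _} _ _ _ _ connectedG _ _ ((connectedT , acyclic) , _ , leaves , edges) z _ =
  LeafRoot.nearLeaf connectedG connectedT acyclic leaves edges z fzero
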